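{- (1) $\mathbb 1(\mathbb Z^+_{\mathcal S})=E_1$; (2) $\mathbb 1(0_{c_{j,\overline j}})=0_{m-2j+1}$ for $j\in\{1,\dots,\lceil m/2\rceil\}$; (3) $\mathbb 1(\omega_j)=(-1)_{m-2j}$ for $j\in\{0,\dots,\lfloor m/2\rfloor\}$.
   Context: $m\ge1$, $\mathcal O=\{1<\dots<m\}$, $\overline x=m+1-x$. Primary-coloured integers $k_{c_j}$ ($k\in\mathbb Z$, $j\in\mathcal O$); secondary-coloured integers $k_{c_{x,y}}$ ($x\le y$) form $\mathbb Z_{\mathcal S}$, with $\eta(2k_{c_{x,y}})=k_{c_y}$, $\zeta(2k_{c_{x,y}})=k_{c_x}$, $\eta((2k+1)_{c_{x,y}})=(k+1)_{c_x}$, $\zeta((2k+1)_{c_{x,y}})=k_{c_y}$. $\mathbb 1(k_{c_j})=km-\frac{m+1}{2}+j$; for $e\in\mathbb Z_{\mathcal S}$, $\mathbb 1(e)$ is the symbol $l_d$ with $l=\mathbb 1(\eta(e))+\mathbb 1(\zeta(e))$ and $d=\mathbb 1(\eta(e))-\mathbb 1(\zeta(e))$. $E_k=\{l_d:l\ge k,\ d\in\{0,\dots,m\},\ l-d\equiv m+1\pmod2\}$. $\mathbb Z^+_{\mathcal S}=\{0_{c_{x,y}}:m\ge y\ge x>\overline y\ge1\}\sqcup\{k_c\in\mathbb Z_{\mathcal S}:k>0\}$. $\omega_0=(-1)_{c_{m,m}}$, $\omega_i=0_{c_{i,\overline{i+1}}}$ for $1\le i\le\lfloor m/2\rfloor$.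 -}

module Defs where

open import Data.Nat as ℕ using (ℕ; zero; suc)
open import Data.Integer as ℤ using (ℤ; +_; _+_; _-_; _*_; -_)
open import Data.Integer.DivMod using (_/ℕ_; _%ℕ_)
open import Data.Integer.Divisibility using (_∣_)
open import Data.Product using (_×_; _,_)
open import Data.Sum using (_⊎_)
open import Relation.Binary.PropositionalEquality using (_≡_)

-- Primary-coloured integer k_{c_j}: a pair (k , j), j ∈ {1,…,m}.
record PCInt : Set where
  constructor pc
  field
    val : ℤ
    col : ℕ

-- Secondary-coloured integer k_{c_{x,y}}: a triple (k , x , y).
record SCInt : Set where
  constructor sc
  field
    val : ℤ
    cx  : ℕ
    cy  : ℕ

open SCInt public

ValidSC : ℕ → SCInt → Set
ValidSC m e = (1 ℕ.≤ cx e) × (cx e ℕ.≤ cy e) × (cy e ℕ.≤ m)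

bar : ℕ → ℕ → ℕ
bar m x = suc m ℕ.∸ x

half : ℤ → ℤ
half n = n /ℕ 2

par : ℤ → ℕ
par n = n %ℕ 2

η : SCInt → PCInt
η (sc n x y) with par n
... | zero  = pc (half n) y
... | suc _ = pc (half n + + 1) x

ζ : SCInt → PCInt
ζ (sc n x y) with par n
... | zero  = pc (half n) x
... | suc _ = pc (half n) y

-- 𝟙(k_{c_j}) = k m - (m+1)/2 + j.  To stay in ℤ we use the shifted value
-- 𝟙'(k_{c_j}) = k m + j, so that 𝟙 = 𝟙' - (m+1)/2.
𝟙' : ℕ → PCInt → ℤ
𝟙' m (pc k j) = k * + m + + j

-- 𝟙(e) = l_d with l = 𝟙(η e) + 𝟙(ζ e) = 𝟙'(η e) + 𝟙'(ζ e) - (m+1)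
-- and d = 𝟙(η e) - 𝟙(ζ e) = 𝟙'(η e) - 𝟙'(ζ e).  Symbols l_d are pairs (l , d).
𝟙 : ℕ → SCInt → ℤ × ℤ
𝟙 m e = (𝟙' m (η e) + 𝟙' m (ζ e) - + suc m , 𝟙' m (η e) - 𝟙' m (ζ e))

E : ℕ → ℤ → ℤ × ℤ → Set
E m k (l , d) = (k ℤ.≤ l) × (+ 0 ℤ.≤ d) × (d ℤ.≤ + m) × (+ 2 ∣ (l - d - + suc m))

InZS⁺ : ℕ → SCInt → Set
InZS⁺ m e =
  ((val e ≡ + 0) × (cy e ℕ.≤ m) × (cx e ℕ.≤ cy e) × (bar m (cy e) ℕ.< cx e) × (1 ℕ.≤ bar m (cy e)))
  ⊎ (+ 0 ℤ.< val e)

ω : ℕ → ℕ → SCInt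
ω m zero    = sc (- + 1) m m
ω m (suc i) = sc (+ 0) (suc i) (bar m (suc (suc i)))

{-# OPTIONS --safe #-}
module Submission where

-- Write p = 𝟙'(η e) and q = 𝟙'(ζ e) for the shifted values of the two primary components of e.
-- Then 𝟙(e) = (p + q - (m+1))_{p - q}, and l - d - (m+1) = 2 (q - (m+1)) is even for free, so
-- E₁ consists exactly of the symbols of pairs with q ≤ p ≤ q + m and p + q > m + 1
-- ("admissible" pairs).  For e ∈ ℤ⁺_S these inequalities follow from 1 ≤ x ≤ y ≤ m (and from
-- x > ȳ when e = 0_{c_{x,y}}).  Conversely write q = km + x with 1 ≤ x ≤ m and p = q + d: the
-- preimage is (2k)_{c_{x,x+d}} if x + d ≤ m, and (2k+1)_{c_{x+d-m,x}} otherwise; for k = 0 the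
-- first one lies in ℤ⁺_S precisely because p + q > m + 1 says x > \overline{x+d}.

open import Defs
open import Data.Nat as ℕ using (ℕ; zero; suc; z≤n; s≤s; _+_; _*_; _∸_; _≤_; _<_; _≤?_; ⌈_/2⌉; ⌊_/2⌋)
import Data.Nat.Properties as ℕₚ
open import Data.Nat.DivMod using (m*n%n≡0; m*n/n≡m; [m+kn]%n≡m%n; +-distrib-/-∣ʳ; m%n<n; m≡m%n+[m/n]*n; _%_; _/_)
open import Data.Nat.Divisibility using (divides-refl)
open import Data.Integer as ℤ using (ℤ; +_; _-_; -_; +≤+; +<+)
import Data.Integer.Properties as ℤₚ
open import Data.Integer.Divisibility using (_∣_; divides)
import Data.Integer.Divisibility.Signed as Signed
open import Data.Integer.Tactic.RingSolver using (solve-∀)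
import Data.Nat.Tactic.RingSolver as ℕ-Solver
open import Data.Product using (_×_; _,_; ∃-syntax; ∃₂)
open import Data.Sum using (inj₁; inj₂)
open import Data.Empty using (⊥-elim)
open import Relation.Binary.PropositionalEquality
open import Relation.Nullary using (yes; no)

pos-∸ : ∀ {m n} → n ≤ m → + (m ∸ n) ≡ + m - + n
pos-∸ {m} {n} n≤m = sym (trans (ℤₚ.[+m]-[+n]≡m⊖n m n) (ℤₚ.⊖-≥ n≤m))

a+b-b≡a : ∀ a b → a ℤ.+ b - b ≡ a
a+b-b≡a = solve-∀

a+b-a≡b : ∀ a b → a ℤ.+ b - a ≡ b
a+b-a≡b = solve-∀

2∣l-d-M⇒2∣l+d+M : ∀ l d M → + 2 ∣ l - d - M → + 2 ∣ l ℤ.+ d ℤ.+ M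
2∣l-d-M⇒2∣l+d+M l d M 2∣l-d-M =
  Signed.∣⇒∣ᵤ (subst (Signed._∣_ (+ 2)) (sym (l+d+M≡l-d-M+[d+M]*2 l d M))
    (Signed.∣m∣n⇒∣m+n (Signed.∣ᵤ⇒∣ {i = l - d - M} 2∣l-d-M) (Signed.divides (d ℤ.+ M) refl)))
  where
  l+d+M≡l-d-M+[d+M]*2 : ∀ l d M → l ℤ.+ d ℤ.+ M ≡ l - d - M ℤ.+ (d ℤ.+ M) ℤ.* + 2
  l+d+M≡l-d-M+[d+M]*2 = solve-∀

data Parity : ℕ → Set where
  even : ∀ k → Parity (k * 2)
  odd  : ∀ k → Parity (suc (k * 2))

parity : ∀ n → Parity n
parity zero          = even 0
parity (suc zero)    = odd 0
parity (suc (suc n)) with parity n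
... | even k = even (suc k)
... | odd k  = odd (suc k)

[1+k*2]/2≡k : ∀ k → suc (k * 2) / 2 ≡ k
[1+k*2]/2≡k k = trans (+-distrib-/-∣ʳ 1 {d = 2} (divides-refl k)) (m*n/n≡m k 2)

-- `rewrite` does not run instance search, hence the explicit `NonZero 2` arguments.
η-even : ∀ k x y → η (sc (+ (k * 2)) x y) ≡ pc (+ k) y
η-even k x y rewrite m*n%n≡0 k 2 ⦃ ℕ.nonZero ⦄ | m*n/n≡m k 2 ⦃ ℕ.nonZero ⦄ = refl

ζ-even : ∀ k x y → ζ (sc (+ (k * 2)) x y) ≡ pc (+ k) x
ζ-even k x y rewrite m*n%n≡0 k 2 ⦃ ℕ.nonZero ⦄ | m*n/n≡m k 2 ⦃ ℕ.nonZero ⦄ = refl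

η-odd : ∀ k x y → η (sc (+ suc (k * 2)) x y) ≡ pc (+ suc k) x
η-odd k x y rewrite [m+kn]%n≡m%n 1 k 2 ⦃ ℕ.nonZero ⦄ | [1+k*2]/2≡k k =
  cong (λ n → pc (+ n) x) (ℕₚ.+-comm k 1)

ζ-odd : ∀ k x y → ζ (sc (+ suc (k * 2)) x y) ≡ pc (+ k) y
ζ-odd k x y rewrite [m+kn]%n≡m%n 1 k 2 ⦃ ℕ.nonZero ⦄ | [1+k*2]/2≡k k = refl

𝟙'-pos : ∀ m k j → 𝟙' m (pc (+ k) j) ≡ + (k * m + j)
𝟙'-pos m k j = cong (ℤ._+ + j) (sym (ℤₚ.pos-* k m))

symbol : ℕ → ℤ → ℤ → ℤ × ℤ
symbol m p q = (p ℤ.+ q - + suc m , p - q)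

𝟙-even : ∀ m k x y →
         𝟙 m (sc (+ (k * 2)) x y) ≡ symbol m (+ (k * m + y)) (+ (k * m + x))
𝟙-even m k x y = cong₂ (symbol m)
  (trans (cong (𝟙' m) (η-even k x y)) (𝟙'-pos m k y))
  (trans (cong (𝟙' m) (ζ-even k x y)) (𝟙'-pos m k x))

𝟙-odd : ∀ m k x y →
        𝟙 m (sc (+ suc (k * 2)) x y) ≡ symbol m (+ (k * m + (m + x))) (+ (k * m + y))
𝟙-odd m k x y = cong₂ (symbol m)
  (trans (cong (𝟙' m) (η-odd k x y)) (trans (𝟙'-pos m (suc k) x) (cong +_ [1+k]*m+x≡k*m+[m+x])))
  (trans (cong (𝟙' m) (ζ-odd k x y)) (𝟙'-pos m k y))
  where
  [1+k]*m+x≡k*m+[m+x] : suc k * m + x ≡ k * m + (m + x)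
  [1+k]*m+x≡k*m+[m+x] = trans (cong (_+ x) (ℕₚ.+-comm m (k * m))) (ℕₚ.+-assoc (k * m) m x)

Admissible : ℕ → ℕ → ℕ → Set
Admissible m p q = suc m < p + q × q ≤ p × p ≤ q + m

symbol∈E₁ : ∀ {m p q} → Admissible m p q → E m (+ 1) (symbol m (+ p) (+ q))
symbol∈E₁ {m} {p} {q} (1+m<p+q , q≤p , p≤q+m) =
  subst (+ 1 ℤ.≤_) (pos-∸ (ℕₚ.<⇒≤ 1+m<p+q)) (+≤+ (ℕₚ.m<n⇒0<n∸m 1+m<p+q)) ,
  subst (+ 0 ℤ.≤_) (pos-∸ q≤p) (+≤+ z≤n) ,
  subst (ℤ._≤ + m) (pos-∸ q≤p) (+≤+ (ℕₚ.m≤n+o⇒m∸n≤o p q p≤q+m)) ,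
  Signed.∣⇒∣ᵤ (Signed.divides (+ q - + suc m) (l-d-M≡[q-M]*2 (+ p) (+ q) (+ suc m)))
  where
  l-d-M≡[q-M]*2 : ∀ p q M → p ℤ.+ q - M - (p - q) - M ≡ (q - M) ℤ.* + 2
  l-d-M≡[q-M]*2 = solve-∀

E₁-halve : ∀ {m L D a} → 1 ≤ L → D ≤ m → L + D + suc m ≡ a * 2 → ∃[ q ] q + D + q ≡ L + suc m
E₁-halve {m} {L} {D} {a} 1≤L D≤m L+D+M≡a*2 =
  let q , D+q≡a = ℕₚ.m≤n⇒∃[o]m+o≡n D≤a in
  q , ℕₚ.+-cancelˡ-≡ D _ _ (begin-equality
    D + (q + D + q)  ≡⟨ D+[q+D+q]≡[D+q]*2 D q ⟩
    (D + q) * 2      ≡⟨ cong (_* 2) D+q≡a ⟩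
    a * 2            ≡⟨ L+D+M≡a*2 ⟨
    L + D + suc m    ≡⟨ L+D+M≡D+[L+M] L D (suc m) ⟩
    D + (L + suc m)  ∎)
  where
  open ℕₚ.≤-Reasoning
  D≤a : D ≤ a
  D≤a = ℕₚ.*-cancelʳ-≤ D a 2 (begin
    D * 2          ≡⟨ ℕₚ.*-comm D 2 ⟩
    D + (D + 0)    ≡⟨ cong (D ℕ.+_) (ℕₚ.+-identityʳ D) ⟩
    D + D          ≤⟨ ℕₚ.+-mono-≤ (ℕₚ.m≤n+m D L) (ℕₚ.m≤n⇒m≤1+n D≤m) ⟩
    L + D + suc m  ≡⟨ L+D+M≡a*2 ⟩
    a * 2          ∎)
  D+[q+D+q]≡[D+q]*2 : ∀ D q → D + (q + D + q) ≡ (D + q) * 2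
  D+[q+D+q]≡[D+q]*2 = ℕ-Solver.solve-∀
  L+D+M≡D+[L+M] : ∀ L D M → L + D + M ≡ D + (L + M)
  L+D+M≡D+[L+M] = ℕ-Solver.solve-∀

halved⇒symbol : ∀ {m L D q} → 1 ≤ L → D ≤ m → q + D + q ≡ L + suc m →
                Admissible m (q + D) q × (+ L , + D) ≡ symbol m (+ (q + D)) (+ q)
halved⇒symbol {m} {L} {D} {q} 1≤L D≤m q+D+q≡L+M =
  (subst (suc m <_) (sym q+D+q≡L+M) (ℕₚ.m<n+m (suc m) 1≤L) , ℕₚ.m≤m+n q D , ℕₚ.+-monoʳ-≤ q D≤m) ,
  cong₂ _,_ (trans (sym (a+b-b≡a (+ L) (+ suc m))) (cong (λ n → + n - + suc m) (sym q+D+q≡L+M)))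
            (sym (a+b-a≡b (+ q) (+ D)))

E₁⇒symbol : ∀ {m s} → E m (+ 1) s → ∃₂ λ p q → Admissible m p q × s ≡ symbol m (+ p) (+ q)
E₁⇒symbol {m} {+ L , + D} (+≤+ 1≤L , +≤+ _ , +≤+ D≤m , 2∣l-d-M) =
  let divides a L+D+M≡a*2 = 2∣l-d-M⇒2∣l+d+M (+ L) (+ D) (+ suc m) 2∣l-d-M
      q , q+D+q≡L+M = E₁-halve {a = a} 1≤L D≤m L+D+M≡a*2 in
  q + D , q , halved⇒symbol 1≤L D≤m q+D+q≡L+M

y+ȳ≡1+m : ∀ {m y} → y ≤ suc m → y + bar m y ≡ suc m
y+ȳ≡1+m = ℕₚ.m+[n∸m]≡n

ȳ<x⇒1+m<y+x : ∀ {m x y} → y ≤ suc m → bar m y < x → suc m < y + x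
ȳ<x⇒1+m<y+x {x = x} {y} y≤1+m ȳ<x = subst (_< y + x) (y+ȳ≡1+m y≤1+m) (ℕₚ.+-monoʳ-< y ȳ<x)

1+m<y+x⇒ȳ<x : ∀ {m x y} → y ≤ suc m → suc m < y + x → bar m y < x
1+m<y+x⇒ȳ<x {x = x} {y} y≤1+m 1+m<y+x =
  ℕₚ.+-cancelˡ-< y _ _ (subst (_< y + x) (sym (y+ȳ≡1+m y≤1+m)) 1+m<y+x)

admissible-zero : ∀ {m x y} → x ≤ y → y ≤ m → bar m y < x → Admissible m y x
admissible-zero {m} {x} x≤y y≤m ȳ<x =
  ȳ<x⇒1+m<y+x (ℕₚ.m≤n⇒m≤1+n y≤m) ȳ<x , x≤y , ℕₚ.≤-trans y≤m (ℕₚ.m≤n+m m x)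

module _ {m c x y : ℕ} (1≤x : 1 ≤ x) (x≤y : x ≤ y) (y≤m : y ≤ m) where
  open ℕₚ.≤-Reasoning

  admissible-even : m ≤ c → Admissible m (c + y) (c + x)
  admissible-even m≤c = sum , ℕₚ.+-monoʳ-≤ c x≤y , bound
    where
    sum : suc m < c + y + (c + x)
    sum = begin-strict
      suc m              ≡⟨ ℕₚ.+-comm 1 m ⟩
      m + 1              ≤⟨ ℕₚ.+-mono-≤ m≤c (ℕₚ.≤-trans 1≤x x≤y) ⟩
      c + y              <⟨ ℕₚ.m<m+n _ (ℕₚ.≤-trans 1≤x (ℕₚ.m≤n+m x c)) ⟩
      c + y + (c + x)    ∎
    bound : c + y ≤ c + x + m
    bound = begin
      c + y              ≤⟨ ℕₚ.+-monoʳ-≤ c (ℕₚ.≤-trans y≤m (ℕₚ.m≤n+m m x)) ⟩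
      c + (x + m)        ≡⟨ ℕₚ.+-assoc c x m ⟨
      c + x + m          ∎

  admissible-odd : Admissible m (c + (m + x)) (c + y)
  admissible-odd = sum , ℕₚ.+-monoʳ-≤ c (ℕₚ.≤-trans y≤m (ℕₚ.m≤m+n m x)) , bound
    where
    sum : suc m < c + (m + x) + (c + y)
    sum = begin-strict
      suc m                  ≡⟨ ℕₚ.+-comm 1 m ⟩
      m + 1                  ≤⟨ ℕₚ.+-monoʳ-≤ m 1≤x ⟩
      m + x                  ≤⟨ ℕₚ.m≤n+m (m + x) c ⟩
      c + (m + x)            <⟨ ℕₚ.m<m+n _ (ℕₚ.≤-trans (ℕₚ.≤-trans 1≤x x≤y) (ℕₚ.m≤n+m y c)) ⟩
      c + (m + x) + (c + y)  ∎
    bound : c + (m + x) ≤ c + y + m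
    bound = begin
      c + (m + x)            ≤⟨ ℕₚ.+-monoʳ-≤ c (ℕₚ.+-monoʳ-≤ m x≤y) ⟩
      c + (m + y)            ≡⟨ cong (c ℕ.+_) (ℕₚ.+-comm m y) ⟩
      c + (y + m)            ≡⟨ ℕₚ.+-assoc c y m ⟨
      c + y + m              ∎

𝟙-ZS⁺-admissible : ∀ {m e} → ValidSC m e → InZS⁺ m e →
                   ∃₂ λ p q → Admissible m p q × 𝟙 m e ≡ symbol m (+ p) (+ q)
𝟙-ZS⁺-admissible {m} {sc .(+ 0) x y} (_ , x≤y , y≤m) (inj₁ (refl , _ , _ , ȳ<x , _)) =
  y , x , admissible-zero x≤y y≤m ȳ<x , 𝟙-even m 0 x y
𝟙-ZS⁺-admissible {m} {sc (+ n) x y} (1≤x , x≤y , y≤m) (inj₂ (+<+ _)) with parity n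
𝟙-ZS⁺-admissible {m} {sc (+ .0) x y} _ (inj₂ (+<+ ())) | even zero
... | even (suc k) =
  suc k * m + y , suc k * m + x ,
  admissible-even 1≤x x≤y y≤m (ℕₚ.m≤n*m m (suc k)) , 𝟙-even m (suc k) x y
... | odd k =
  k * m + (m + x) , k * m + y , admissible-odd 1≤x x≤y y≤m , 𝟙-odd m k x y

𝟙-ZS⁺⊆E₁ : ∀ {m e} → ValidSC m e → InZS⁺ m e → E m (+ 1) (𝟙 m e)
𝟙-ZS⁺⊆E₁ {m} valid inZS⁺ =
  let _ , _ , admissible , 𝟙e≡symbol = 𝟙-ZS⁺-admissible valid inZS⁺ in
  subst (E m (+ 1)) (sym 𝟙e≡symbol) (symbol∈E₁ admissible)

In𝟙ZS⁺ : ℕ → ℤ × ℤ → Set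
In𝟙ZS⁺ m s = ∃[ e ] (ValidSC m e × InZS⁺ m e × 𝟙 m e ≡ s)

module _ {m : ℕ} (k : ℕ) {x y : ℕ} (1≤x : 1 ≤ x) (x≤y : x ≤ y) (y≤m : y ≤ m) where

  In𝟙ZS⁺-even : suc m < k * m + y + (k * m + x) →
                In𝟙ZS⁺ m (symbol m (+ (k * m + y)) (+ (k * m + x)))
  In𝟙ZS⁺-even sum = sc (+ (k * 2)) x y , (1≤x , x≤y , y≤m) , inZS⁺ k sum , 𝟙-even m k x y
    where
    inZS⁺ : ∀ k → suc m < k * m + y + (k * m + x) → InZS⁺ m (sc (+ (k * 2)) x y)
    inZS⁺ zero    1+m<y+x = inj₁ (refl , y≤m , x≤y ,
      1+m<y+x⇒ȳ<x (ℕₚ.m≤n⇒m≤1+n y≤m) 1+m<y+x , ℕₚ.m<n⇒0<n∸m (s≤s y≤m))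
    inZS⁺ (suc _) _       = inj₂ (+<+ (s≤s z≤n))

  In𝟙ZS⁺-odd : In𝟙ZS⁺ m (symbol m (+ (k * m + (m + x))) (+ (k * m + y)))
  In𝟙ZS⁺-odd = sc (+ suc (k * 2)) x y , (1≤x , x≤y , y≤m) , inj₂ (+<+ (s≤s z≤n)) , 𝟙-odd m k x y

module _ {m : ℕ} (k : ℕ) {x d : ℕ} (1≤x : 1 ≤ x) (x≤m : x ≤ m) (d≤m : d ≤ m) where
  private
    c : ℕ
    c = k * m

  In𝟙ZS⁺-coloured : suc m < c + x + d + (c + x) → In𝟙ZS⁺ m (symbol m (+ (c + x + d)) (+ (c + x)))
  In𝟙ZS⁺-coloured sum with x + d ≤? m
  ... | yes x+d≤m =
    subst (λ P → In𝟙ZS⁺ m (symbol m (+ P) (+ (c + x)))) (sym (ℕₚ.+-assoc c x d))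
      (In𝟙ZS⁺-even k 1≤x (ℕₚ.m≤m+n x d) x+d≤m
        (subst (λ P → suc m < P + (c + x)) (ℕₚ.+-assoc c x d) sum))
  ... | no x+d≰m with ℕₚ.m≤n⇒∃[o]m+o≡n (ℕₚ.≰⇒> x+d≰m)
  ... | o , 1+m+o≡x+d =
    subst (λ P → In𝟙ZS⁺ m (symbol m (+ P) (+ (c + x))))
      (trans (cong (c ℕ.+_) m+[1+o]≡x+d) (sym (ℕₚ.+-assoc c x d)))
      (In𝟙ZS⁺-odd k (s≤s z≤n) 1+o≤x x≤m)
    where
    open ℕₚ.≤-Reasoning
    m+[1+o]≡x+d : m + suc o ≡ x + d
    m+[1+o]≡x+d = trans (ℕₚ.+-suc m o) 1+m+o≡x+d
    1+o≤x : suc o ≤ x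
    1+o≤x = ℕₚ.+-cancelˡ-≤ m (suc o) x (begin
      m + suc o  ≡⟨ m+[1+o]≡x+d ⟩
      x + d      ≤⟨ ℕₚ.+-monoʳ-≤ x d≤m ⟩
      x + m      ≡⟨ ℕₚ.+-comm x m ⟩
      m + x      ∎)

colour-decomposition : ∀ {m q} → 1 ≤ m → 1 ≤ q → ∃₂ λ k x → 1 ≤ x × x ≤ m × k * m + x ≡ q
colour-decomposition {suc m'} {suc q'} _ _ =
  q' / m , suc (q' % m) , s≤s z≤n , m%n<n q' m , km+[1+r]≡1+q'
  where
  m : ℕ
  m = suc m'
  km+[1+r]≡1+q' : q' / m * m + suc (q' % m) ≡ suc q'
  km+[1+r]≡1+q' = trans (ℕₚ.+-suc _ _)
    (cong suc (trans (ℕₚ.+-comm (q' / m * m) (q' % m)) (sym (m≡m%n+[m/n]*n q' m))))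

admissible⇒1≤q : ∀ {m p q} → Admissible m p q → 1 ≤ q
admissible⇒1≤q {m} {p} {zero} (1+m<p+0 , _ , p≤m) =
  ⊥-elim (ℕₚ.<⇒≱ 1+m<p+0 (subst (_≤ suc m) (sym (ℕₚ.+-identityʳ p)) (ℕₚ.m≤n⇒m≤1+n p≤m)))
admissible⇒1≤q {q = suc _} _ = s≤s z≤n

admissible⇒In𝟙ZS⁺ : ∀ {m p q} → 1 ≤ m → Admissible m p q → In𝟙ZS⁺ m (symbol m (+ p) (+ q))
admissible⇒In𝟙ZS⁺ {m} 1≤m adm@(_ , q≤p , _)
  with ℕₚ.m≤n⇒∃[o]m+o≡n q≤p | colour-decomposition 1≤m (admissible⇒1≤q adm)
... | d , refl | k , x , 1≤x , x≤m , refl with adm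
... | sum , _ , q+d≤q+m = In𝟙ZS⁺-coloured k 1≤x x≤m (ℕₚ.+-cancelˡ-≤ (k * m + x) d m q+d≤q+m) sum

E₁⊆𝟙-ZS⁺ : ∀ {m s} → 1 ≤ m → E m (+ 1) s → In𝟙ZS⁺ m s
E₁⊆𝟙-ZS⁺ {m} 1≤m s∈E₁ =
  let _ , _ , admissible , s≡symbol = E₁⇒symbol s∈E₁ in
  subst (In𝟙ZS⁺ m) (sym s≡symbol) (admissible⇒In𝟙ZS⁺ 1≤m admissible)

𝟙-0-bar : ∀ m x {y} → y ≤ suc m → 𝟙 m (sc (+ 0) x (bar m y)) ≡ (+ x - + y , + suc m - + y - + x)
𝟙-0-bar m x {y} y≤1+m = begin
  𝟙 m (sc (+ 0) x (bar m y))         ≡⟨ 𝟙-even m 0 x (bar m y) ⟩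
  symbol m (+ (bar m y)) (+ x)       ≡⟨ cong (λ b → symbol m b (+ x)) (pos-∸ y≤1+m) ⟩
  symbol m (+ suc m - + y) (+ x)     ≡⟨ cong (_, + suc m - + y - + x)
                                             (M-y+x-M≡x-y (+ suc m) (+ y) (+ x)) ⟩
  (+ x - + y , + suc m - + y - + x)  ∎
  where
  open ≡-Reasoning
  M-y+x-M≡x-y : ∀ M y x → M - y ℤ.+ x - M ≡ x - y
  M-y+x-M≡x-y = solve-∀

𝟙-0-self-bar : ∀ m j → j ≤ ⌈ m /2⌉ → 𝟙 m (sc (+ 0) j (bar m j)) ≡ (+ 0 , + m - + (2 * j) ℤ.+ + 1)
𝟙-0-self-bar m j j≤⌈m/2⌉ =
  trans (𝟙-0-bar m j (ℕₚ.m≤n⇒m≤1+n (ℕₚ.≤-trans j≤⌈m/2⌉ (ℕₚ.⌈n/2⌉≤n m))))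
    (cong₂ _,_ (ℤₚ.+-inverseʳ (+ j))
               (trans (1+M-J-J≡M-2J+1 (+ m) (+ j))
                      (cong (λ t → + m - t ℤ.+ + 1) (sym (ℤₚ.pos-* 2 j)))))
  where
  1+M-J-J≡M-2J+1 : ∀ M J → + 1 ℤ.+ M - J - J ≡ M - + 2 ℤ.* J ℤ.+ + 1
  1+M-J-J≡M-2J+1 = solve-∀

𝟙-ω : ∀ m j → j ≤ ⌊ m /2⌋ → 𝟙 m (ω m j) ≡ (- + 1 , + m - + (2 * j))
𝟙-ω m zero _ = cong₂ _,_ (l≡-1 (+ m)) (d≡M (+ m))
  where
  l≡-1 : ∀ M → M ℤ.+ (- + 1 ℤ.* M ℤ.+ M) - (+ 1 ℤ.+ M) ≡ - + 1
  l≡-1 = solve-∀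
  d≡M : ∀ M → M - (- + 1 ℤ.* M ℤ.+ M) ≡ M - + 0
  d≡M = solve-∀
𝟙-ω m (suc i) 1+i≤⌊m/2⌋ =
  trans (𝟙-0-bar m (suc i) (s≤s (ℕₚ.≤-trans 1+i≤⌊m/2⌋ (ℕₚ.⌊n/2⌋≤n m))))
    (cong₂ _,_ (l≡-1 (+ i))
               (trans (d≡M-2J (+ m) (+ i)) (cong (λ t → + m - t) (sym (ℤₚ.pos-* 2 (suc i))))))
  where
  l≡-1 : ∀ I → + 1 ℤ.+ I - (+ 1 ℤ.+ (+ 1 ℤ.+ I)) ≡ - + 1
  l≡-1 = solve-∀
  d≡M-2J : ∀ M I → + 1 ℤ.+ M - (+ 1 ℤ.+ (+ 1 ℤ.+ I)) - (+ 1 ℤ.+ I) ≡ M - + 2 ℤ.* (+ 1 ℤ.+ I)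
  d≡M-2J = solve-∀

lemma5p11 : (m : ℕ) → 1 ℕ.≤ m →
    -- (1) 𝟙(ℤ⁺_S) = E_1
    (((e : SCInt) → ValidSC m e → InZS⁺ m e → E m (+ 1) (𝟙 m e))
      × ((p : ℤ × ℤ) → E m (+ 1) p → ∃[ e ] (ValidSC m e × InZS⁺ m e × 𝟙 m e ≡ p)))
    -- (2) 𝟙(0_{c_{j, j̄}}) = 0_{m-2j+1}
    × ((j : ℕ) → 1 ℕ.≤ j → j ℕ.≤ ⌈ m /2⌉ →
        𝟙 m (sc (+ 0) j (bar m j)) ≡ (+ 0 , + m - ℤ.+ (2 ℕ.* j) ℤ.+ + 1))
    -- (3) 𝟙(ω_j) = (-1)_{m-2j}
    × ((j : ℕ) → j ℕ.≤ ⌊ m /2⌋ →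
        𝟙 m (ω m j) ≡ (- + 1 , + m - + (2 ℕ.* j)))
lemma5p11 m 1≤m =
  ((λ _ → 𝟙-ZS⁺⊆E₁) , (λ _ → E₁⊆𝟙-ZS⁺ 1≤m)) ,
  (λ j _ → 𝟙-0-self-bar m j) ,
  𝟙-ω m
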